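{- For all integers $1\le a\le n$ and all $r\ge1$, \[ ([r]_q)^{a}\sum_{s=0}^{n-a}\binom{a-1+s}{a-1}q^{rs} =\sum_{i=1}^n\sum_{j=0}^{r-1}\sum_{t=0}^{a-1}\binom{n-i}{t}\binom{i-1}{a-t-1}q^{j(n-a+1)+(n-i-t)}[j]_q^{\,a-t-1}[j+1]_q^{\,t}. \]
   Context: $[m]_q=1+q+\cdots+q^{m-1}$ for $m\ge 1$, $[0]_q=0$, with the convention $[0]_q^0=1$; binomial coefficients $\binom{x}{y}$ with $y>x\ge 0$ are $0$. -}

module Defs where

open import Level using (Level)
open import Data.Nat using (ℕ; zero; suc; _∸_)
open import Data.Nat.Combinatorics using (_C_)
open import Algebra.Bundles using (CommutativeSemiring)
import Algebra.Definitions.RawSemiring as RS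

-- Definitions over an arbitrary commutative semiring R, with q ∈ R.
-- (An identity between polynomials in q with natural coefficients
--  is exactly an identity holding for every q in every commutative
--  semiring, since ℕ[q] is the free commutative semiring on q.)
module QDefs {c ℓ : Level} (R : CommutativeSemiring c ℓ) where
  open CommutativeSemiring R renaming (Carrier to A)
  open RS rawSemiring using (_×_; _^_) public

  Σ< : ℕ → (ℕ → A) → A
  Σ< zero    f = 0#
  Σ< (suc m) f = Σ< m f + f m

  qint : A → ℕ → A
  qint q m = Σ< m (λ k → q ^ k)

  lhs : A → ℕ → ℕ → ℕ → A
  lhs q n a r =
    (qint q r ^ a) * Σ< (suc (n ∸ a)) (λ s → ((a ∸ 1 Data.Nat.+ s) C (a ∸ 1)) × (q ^ (r Data.Nat.* s)))

  rhs : A → ℕ → ℕ → ℕ → A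
  rhs q n a r =
    Σ< n (λ i′ → let i = suc i′ in
      Σ< r (λ j →
        Σ< a (λ t →
          (((n ∸ i) C t) Data.Nat.* ((i ∸ 1) C (a ∸ t ∸ 1))) ×
            ((q ^ ((j Data.Nat.* (n ∸ a Data.Nat.+ 1)) Data.Nat.+ (n ∸ i ∸ t)))
              * ((qint q j ^ (a ∸ t ∸ 1)) * (qint q (suc j) ^ t))))))

module Submission where

-- Proposition 4.6 is an identity of polynomials in q with natural
-- coefficients, so it is proved for an arbitrary element q of an arbitrary
-- commutative semiring R, by generating functions in a second variable x.
-- Over the power series R[[x]] put
--   G k = Σ_l q^(kl) x^l,   H = Σ_l x^l,   B j = [j]_q G j,   D j = q^j G j G (j+1).
-- Since G r ^ a = Σ_s C(a-1+s, a-1) q^(rs) x^s, the left-hand side is the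
-- coefficient of x^(n-a) in B r ^ a · H.  A q-integer computation gives the
-- one-step law  B (j+1) H = B j H + D j,  and a telescoping law valid in every
-- commutative semiring (P h = B h + D  ⇒  P^a h = B^a h + Σ_t B^(a-t-1) P^t D),
-- chained from B 0 = 0 up to B r, rewrites
--   B r ^ a · H = Σ_{j<r} Σ_{t<a} B j ^ (a-t-1) · B (j+1) ^ t · D j.
-- Each summand is a Cauchy product of two binomial-geometric series, and its
-- coefficient of x^(n-a) is the (j,t)-row of the right-hand side after the
-- substitution i = (a-t-1) + l + 1 (all other i contribute 0).

open import Defs
open import Level using (Level)
open import Data.Nat as ℕ using (ℕ; zero; suc; _∸_; _<_; _≤_; z≤n; s≤s)
import Data.Nat.Properties as ℕP
open import Data.Nat.Combinatorics using (_C_; nCn≡1; nCk+nC[k+1]≡[n+1]C[k+1]; k>n⇒nCk≡0)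
open import Data.Nat.Solver using (module +-*-Solver)
open import Data.Product using (_,_)
open import Algebra.Bundles using (CommutativeSemiring)
open import Algebra.Structures using (IsCommutativeMonoid)
open import Algebra.Structures.Biased using (isCommutativeSemiringˡ)
open import Relation.Binary.Structures using (IsEquivalence)
open import Relation.Binary.PropositionalEquality as ≡ using (_≡_)

open QDefs ℕP.+-*-commutativeSemiring using () renaming (Σ< to Σℕ)

hockey-stick : ∀ m l → Σℕ (suc l) (λ i → (m ℕ.+ i) C m) ≡ suc (m ℕ.+ l) C suc m
hockey-stick m zero = begin
  (m ℕ.+ 0) C m         ≡⟨ ≡.cong (_C m) (ℕP.+-identityʳ m) ⟩
  m C m                 ≡⟨ nCn≡1 m ⟩
  1                     ≡⟨ ≡.sym (nCn≡1 (suc m)) ⟩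
  suc m C suc m         ≡⟨ ≡.cong (λ k → suc k C suc m) (≡.sym (ℕP.+-identityʳ m)) ⟩
  suc (m ℕ.+ 0) C suc m ∎
  where open ≡.≡-Reasoning
hockey-stick m (suc l) = begin
  Σℕ (suc l) (λ i → (m ℕ.+ i) C m) ℕ.+ (m ℕ.+ suc l) C m
    ≡⟨ ≡.cong₂ ℕ._+_ (hockey-stick m l) (≡.cong (_C m) (ℕP.+-suc m l)) ⟩
  suc (m ℕ.+ l) C suc m ℕ.+ suc (m ℕ.+ l) C m
    ≡⟨ ℕP.+-comm (suc (m ℕ.+ l) C suc m) _ ⟩
  suc (m ℕ.+ l) C m ℕ.+ suc (m ℕ.+ l) C suc m
    ≡⟨ nCk+nC[k+1]≡[n+1]C[k+1] (suc (m ℕ.+ l)) m ⟩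
  suc (suc (m ℕ.+ l)) C suc m
    ≡⟨ ≡.cong (λ k → suc k C suc m) (≡.sym (ℕP.+-suc m l)) ⟩
  suc (m ℕ.+ suc l) C suc m ∎
  where open ≡.≡-Reasoning

module FiniteSums {c ℓ : Level} (S : CommutativeSemiring c ℓ) where
  open CommutativeSemiring S renaming (Carrier to A) hiding (zero)
  open QDefs S using (Σ<; _×_)
  open import Relation.Binary.Reasoning.Setoid setoid
  open import Algebra.Properties.Monoid.Mult +-monoid using (×-homo-+)

  Σ-cong : ∀ m {f g : ℕ → A} → (∀ i → i < m → f i ≈ g i) → Σ< m f ≈ Σ< m g
  Σ-cong zero    eq = refl
  Σ-cong (suc m) eq = +-cong (Σ-cong m (λ i i<m → eq i (ℕP.m<n⇒m<1+n i<m))) (eq m ℕP.≤-refl)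

  Σ-congᵖ : ∀ m {f g : ℕ → A} → (∀ i → f i ≈ g i) → Σ< m f ≈ Σ< m g
  Σ-congᵖ m eq = Σ-cong m (λ i _ → eq i)

  Σ-zero : ∀ m (f : ℕ → A) → (∀ i → i < m → f i ≈ 0#) → Σ< m f ≈ 0#
  Σ-zero zero    f vanish = refl
  Σ-zero (suc m) f vanish =
    trans (+-cong (Σ-zero m f (λ i i<m → vanish i (ℕP.m<n⇒m<1+n i<m))) (vanish m ℕP.≤-refl))
          (+-identityˡ 0#)

  Σ-+ : ∀ m (f g : ℕ → A) → Σ< m (λ i → f i + g i) ≈ Σ< m f + Σ< m g
  Σ-+ zero    f g = sym (+-identityˡ 0#)
  Σ-+ (suc m) f g = begin
    Σ< m (λ i → f i + g i) + (f m + g m) ≈⟨ +-congʳ (Σ-+ m f g) ⟩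
    (Σ< m f + Σ< m g) + (f m + g m)      ≈⟨ +-assoc _ _ _ ⟩
    Σ< m f + (Σ< m g + (f m + g m))      ≈⟨ +-congˡ (sym (+-assoc _ _ _)) ⟩
    Σ< m f + ((Σ< m g + f m) + g m)      ≈⟨ +-congˡ (+-congʳ (+-comm _ _)) ⟩
    Σ< m f + ((f m + Σ< m g) + g m)      ≈⟨ +-congˡ (+-assoc _ _ _) ⟩
    Σ< m f + (f m + (Σ< m g + g m))      ≈⟨ sym (+-assoc _ _ _) ⟩
    (Σ< m f + f m) + (Σ< m g + g m)      ∎

  Σ-*ˡ : ∀ m (x : A) (f : ℕ → A) → x * Σ< m f ≈ Σ< m (λ i → x * f i)
  Σ-*ˡ zero    x f = zeroʳ x
  Σ-*ˡ (suc m) x f = trans (distribˡ x _ _) (+-congʳ (Σ-*ˡ m x f))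

  Σ-*ʳ : ∀ m (x : A) (f : ℕ → A) → Σ< m f * x ≈ Σ< m (λ i → f i * x)
  Σ-*ʳ zero    x f = zeroˡ x
  Σ-*ʳ (suc m) x f = trans (distribʳ x _ _) (+-congʳ (Σ-*ʳ m x f))

  Σ-× : ∀ m (f : ℕ → ℕ) z → Σ< m (λ i → f i × z) ≈ Σℕ m f × z
  Σ-× zero    f z = refl
  Σ-× (suc m) f z = trans (+-congʳ (Σ-× m f z)) (sym (×-homo-+ z (Σℕ m f) (f m)))

  Σ-split : ∀ m k (f : ℕ → A) → Σ< (m ℕ.+ k) f ≈ Σ< m f + Σ< k (λ i → f (m ℕ.+ i))
  Σ-split m zero f = trans (reflexive (≡.cong (λ z → Σ< z f) (ℕP.+-identityʳ m))) (sym (+-identityʳ _))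
  Σ-split m (suc k) f = begin
    Σ< (m ℕ.+ suc k) f                                ≈⟨ reflexive (≡.cong (λ z → Σ< z f) (ℕP.+-suc m k)) ⟩
    Σ< (m ℕ.+ k) f + f (m ℕ.+ k)                      ≈⟨ +-congʳ (Σ-split m k f) ⟩
    (Σ< m f + Σ< k (λ i → f (m ℕ.+ i))) + f (m ℕ.+ k) ≈⟨ +-assoc _ _ _ ⟩
    Σ< m f + Σ< (suc k) (λ i → f (m ℕ.+ i))           ∎

  Σ-first : ∀ m (f : ℕ → A) → Σ< (suc m) f ≈ f 0 + Σ< m (λ i → f (suc i))
  Σ-first zero    f = trans (+-identityˡ _) (sym (+-identityʳ _))
  Σ-first (suc m) f = trans (+-congʳ (Σ-first m f)) (+-assoc _ _ _)

  Σ-swap : ∀ m k (f : ℕ → ℕ → A) →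
    Σ< m (λ i → Σ< k (λ j → f i j)) ≈ Σ< k (λ j → Σ< m (λ i → f i j))
  Σ-swap zero    k f = sym (Σ-zero k _ (λ _ _ → refl))
  Σ-swap (suc m) k f = begin
    Σ< m (λ i → Σ< k (λ j → f i j)) + Σ< k (λ j → f m j) ≈⟨ +-congʳ (Σ-swap m k f) ⟩
    Σ< k (λ j → Σ< m (λ i → f i j)) + Σ< k (λ j → f m j) ≈⟨ sym (Σ-+ k _ _) ⟩
    Σ< k (λ j → Σ< (suc m) (λ i → f i j))                 ∎

  Σ-reverse : ∀ m (f : ℕ → A) → Σ< m f ≈ Σ< m (λ i → f (m ∸ suc i))
  Σ-reverse zero    f = refl
  Σ-reverse (suc m) f = begin
    Σ< m f + f m                        ≈⟨ +-comm _ _ ⟩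
    f m + Σ< m f                        ≈⟨ +-congˡ (Σ-reverse m f) ⟩
    f m + Σ< m (λ i → f (m ∸ suc i))    ≈⟨ sym (Σ-first m (λ i → f (m ∸ i))) ⟩
    Σ< (suc m) (λ i → f (m ∸ i))        ∎

  Σ-triangle : ∀ n (F : ℕ → ℕ → A) →
    Σ< (suc n) (λ k → Σ< (suc k) (λ i → F i k))
      ≈ Σ< (suc n) (λ i → Σ< (suc (n ∸ i)) (λ l → F i (i ℕ.+ l)))
  Σ-triangle zero    F = refl
  Σ-triangle (suc n) F = begin
    Σ< (suc n) (λ k → Σ< (suc k) (λ i → F i k)) + Σ< (suc (suc n)) (λ i → F i (suc n))
      ≈⟨ +-congʳ (Σ-triangle n F) ⟩
    Row n + (Σ< (suc n) (λ i → F i (suc n)) + F (suc n) (suc n))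
      ≈⟨ sym (+-assoc _ _ _) ⟩
    (Row n + Σ< (suc n) (λ i → F i (suc n))) + F (suc n) (suc n)
      ≈⟨ +-cong (sym (Σ-+ (suc n) _ _)) (sym (trans (+-identityˡ _) (reflexive (≡.cong (F (suc n)) (ℕP.+-identityʳ (suc n)))))) ⟩
    Σ< (suc n) (λ i → Σ< (suc (n ∸ i)) (λ l → F i (i ℕ.+ l)) + F i (suc n)) + Σ< 1 (λ l → F (suc n) (suc n ℕ.+ l))
      ≈⟨ +-cong (Σ-cong (suc n) extend) (reflexive (≡.cong (λ z → Σ< (suc z) (λ l → F (suc n) (suc n ℕ.+ l))) (≡.sym (ℕP.n∸n≡0 n)))) ⟩
    Σ< (suc n) (λ i → Σ< (suc (suc n ∸ i)) (λ l → F i (i ℕ.+ l))) + Σ< (suc (suc n ∸ suc n)) (λ l → F (suc n) (suc n ℕ.+ l))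
      ∎
    where
    Row : ℕ → A
    Row n = Σ< (suc n) (λ i → Σ< (suc (n ∸ i)) (λ l → F i (i ℕ.+ l)))

    -- each row i ≤ n gains the one new entry k = n+1
    extend : ∀ i → i < suc n →
      Σ< (suc (n ∸ i)) (λ l → F i (i ℕ.+ l)) + F i (suc n) ≈ Σ< (suc (suc n ∸ i)) (λ l → F i (i ℕ.+ l))
    extend i (s≤s i≤n) = reflexive (≡.trans
      (≡.cong (λ k → Σ< (suc (n ∸ i)) (λ l → F i (i ℕ.+ l)) + F i k) (≡.sym i+[n∸i+1]≡n+1))
      (≡.cong (λ z → Σ< (suc z) (λ l → F i (i ℕ.+ l))) (≡.sym (ℕP.+-∸-assoc 1 i≤n))))
      where
      i+[n∸i+1]≡n+1 : i ℕ.+ suc (n ∸ i) ≡ suc n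
      i+[n∸i+1]≡n+1 = ≡.trans (ℕP.+-suc i (n ∸ i)) (≡.cong suc (ℕP.m+[n∸m]≡n i≤n))

module PowerSeries {c ℓ : Level} (R : CommutativeSemiring c ℓ) where
  open CommutativeSemiring R renaming (Carrier to A) hiding (zero)
  open QDefs R using (Σ<; _^_)
  open FiniteSums R
  open import Relation.Binary.Reasoning.Setoid setoid

  Series : Set c
  Series = ℕ → A

  infix  4 _≋_
  infixl 6 _⊕_
  infixl 7 _⊛_

  _≋_ : Series → Series → Set ℓ
  f ≋ g = ∀ n → f n ≈ g n

  _⊕_ : Series → Series → Series
  (f ⊕ g) n = f n + g n

  _⊛_ : Series → Series → Series
  (f ⊛ g) n = Σ< (suc n) (λ i → f i * g (n ∸ i))

  zeroSeries : Series
  zeroSeries _ = 0#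

  const : A → Series
  const x zero    = x
  const x (suc _) = 0#

  const-⊛ : ∀ x f n → (const x ⊛ f) n ≈ x * f n
  const-⊛ x f n = begin
    Σ< (suc n) (λ i → const x i * f (n ∸ i))  ≈⟨ Σ-first n _ ⟩
    x * f n + Σ< n (λ i → 0# * f (n ∸ suc i)) ≈⟨ +-congˡ (Σ-zero n _ (λ i _ → zeroˡ _)) ⟩
    x * f n + 0#                              ≈⟨ +-identityʳ _ ⟩
    x * f n                                   ∎

  ⊛-comm : ∀ f g → f ⊛ g ≋ g ⊛ f
  ⊛-comm f g n = begin
    Σ< (suc n) (λ i → f i * g (n ∸ i))             ≈⟨ Σ-reverse (suc n) _ ⟩
    Σ< (suc n) (λ i → f (n ∸ i) * g (n ∸ (n ∸ i))) ≈⟨ Σ-cong (suc n) swap ⟩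
    Σ< (suc n) (λ i → g i * f (n ∸ i))             ∎
    where
    swap : ∀ i → i < suc n → f (n ∸ i) * g (n ∸ (n ∸ i)) ≈ g i * f (n ∸ i)
    swap i (s≤s i≤n) = trans (*-comm _ _) (*-congʳ (reflexive (≡.cong g (ℕP.m∸[m∸n]≡n i≤n))))

  -- Associativity is Fubini over the triangle i ≤ i + l ≤ n.
  ⊛-assoc : ∀ f g h → (f ⊛ g) ⊛ h ≋ f ⊛ (g ⊛ h)
  ⊛-assoc f g h n = begin
    Σ< (suc n) (λ k → Σ< (suc k) (λ i → f i * g (k ∸ i)) * h (n ∸ k))
      ≈⟨ Σ-congᵖ (suc n) (λ k → Σ-*ʳ (suc k) _ _) ⟩
    Σ< (suc n) (λ k → Σ< (suc k) (λ i → f i * g (k ∸ i) * h (n ∸ k)))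
      ≈⟨ Σ-triangle n (λ i k → f i * g (k ∸ i) * h (n ∸ k)) ⟩
    Σ< (suc n) (λ i → Σ< (suc (n ∸ i)) (λ l → f i * g ((i ℕ.+ l) ∸ i) * h (n ∸ (i ℕ.+ l))))
      ≈⟨ Σ-congᵖ (suc n) (λ i → Σ-congᵖ (suc (n ∸ i)) (λ l → reindex i l)) ⟩
    Σ< (suc n) (λ i → Σ< (suc (n ∸ i)) (λ l → f i * (g l * h (n ∸ i ∸ l))))
      ≈⟨ Σ-congᵖ (suc n) (λ i → sym (Σ-*ˡ (suc (n ∸ i)) _ _)) ⟩
    Σ< (suc n) (λ i → f i * Σ< (suc (n ∸ i)) (λ l → g l * h (n ∸ i ∸ l)))
      ∎
    where
    reindex : ∀ i l → f i * g ((i ℕ.+ l) ∸ i) * h (n ∸ (i ℕ.+ l)) ≈ f i * (g l * h (n ∸ i ∸ l))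
    reindex i l = trans (*-assoc _ _ _) (*-congˡ (*-cong
      (reflexive (≡.cong g (ℕP.m+n∸m≡n i l)))
      (reflexive (≡.cong h (≡.sym (ℕP.∸-+-assoc n i l))))))

  ≋-isEquivalence : IsEquivalence _≋_
  ≋-isEquivalence = record
    { refl  = λ n → refl
    ; sym   = λ f≋g n → sym (f≋g n)
    ; trans = λ f≋g g≋h n → trans (f≋g n) (g≋h n)
    }

  ⊕-isCommutativeMonoid : IsCommutativeMonoid _≋_ _⊕_ zeroSeries
  ⊕-isCommutativeMonoid = record
    { isMonoid = record
      { isSemigroup = record
        { isMagma = record
          { isEquivalence = ≋-isEquivalence
          ; ∙-cong        = λ f≋f′ g≋g′ n → +-cong (f≋f′ n) (g≋g′ n)
          }
        ; assoc = λ f g h n → +-assoc _ _ _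
        }
      ; identity = (λ f n → +-identityˡ _) , (λ f n → +-identityʳ _)
      }
    ; comm = λ f g n → +-comm _ _
    }

  ⊛-isCommutativeMonoid : IsCommutativeMonoid _≋_ _⊛_ (const 1#)
  ⊛-isCommutativeMonoid = record
    { isMonoid = record
      { isSemigroup = record
        { isMagma = record
          { isEquivalence = ≋-isEquivalence
          ; ∙-cong        = λ f≋f′ g≋g′ n → Σ-congᵖ (suc n) (λ i → *-cong (f≋f′ i) (g≋g′ (n ∸ i)))
          }
        ; assoc = ⊛-assoc
        }
      ; identity = identityˡ , (λ f n → trans (⊛-comm f (const 1#) n) (identityˡ f n))
      }
    ; comm = ⊛-comm
    }
    where
    identityˡ : ∀ f → const 1# ⊛ f ≋ f
    identityˡ f n = trans (const-⊛ 1# f n) (*-identityˡ _)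

  seriesSemiring : CommutativeSemiring c ℓ
  seriesSemiring = record
    { Carrier = Series
    ; _≈_     = _≋_
    ; _+_     = _⊕_
    ; _*_     = _⊛_
    ; 0#      = zeroSeries
    ; 1#      = const 1#
    ; isCommutativeSemiring = isCommutativeSemiringˡ (record
      { +-isCommutativeMonoid = ⊕-isCommutativeMonoid
      ; *-isCommutativeMonoid = ⊛-isCommutativeMonoid
      ; distribʳ = λ f g h n → trans (Σ-congᵖ (suc n) (λ i → distribʳ _ _ _)) (Σ-+ (suc n) _ _)
      ; zeroˡ    = λ f n → Σ-zero (suc n) _ (λ i _ → zeroˡ _)
      })
    }

  module 𝕊 = CommutativeSemiring seriesSemiring
  open QDefs seriesSemiring public using () renaming (_^_ to _^ˢ_; Σ< to Σˢ)
  open import Algebra.Properties.CommutativeSemiring.Exp seriesSemiring using (^-distrib-*)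

  coeff-Σ : ∀ m (F : ℕ → Series) n → Σˢ m F n ≈ Σ< m (λ i → F i n)
  coeff-Σ zero    F n = refl
  coeff-Σ (suc m) F n = +-congʳ (coeff-Σ m F n)

  const-⊛-⊛ : ∀ x f g n → (const x ⊛ f ⊛ g) n ≈ x * (f ⊛ g) n
  const-⊛-⊛ x f g n = trans (⊛-assoc (const x) f g n) (const-⊛ x (f ⊛ g) n)

  const-* : ∀ x y → const x ⊛ const y ≋ const (x * y)
  const-* x y zero    = const-⊛ x (const y) zero
  const-* x y (suc n) = trans (const-⊛ x (const y) (suc n)) (zeroʳ x)

  const-^ : ∀ x m → const x ^ˢ m ≋ const (x ^ m)
  const-^ x zero    = 𝕊.refl
  const-^ x (suc m) = 𝕊.trans (𝕊.*-congˡ {const x} (const-^ x m)) (const-* x (x ^ m))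

  scaled-^ : ∀ x F m → (const x ⊛ F) ^ˢ m ≋ const (x ^ m) ⊛ F ^ˢ m
  scaled-^ x F m = 𝕊.trans (^-distrib-* (const x) F m) (𝕊.*-congʳ {F ^ˢ m} (const-^ x m))

-- Telescoping in a commutative semiring: if P h = B h + D then
--   P^a h = B^a h + (Σ_{t<a} B^(a-t-1) P^t) D,
-- the multiplicative analogue of P^a - B^a = (P - B) Σ_t B^(a-t-1) P^t.
module Telescoping {c ℓ : Level} (S : CommutativeSemiring c ℓ) where
  open CommutativeSemiring S renaming (Carrier to A) hiding (zero)
  open QDefs S using (Σ<; _^_)
  open FiniteSums S
  open import Relation.Binary.Reasoning.Setoid setoid
  open import Algebra.Solver.Ring.NaturalCoefficients.Default S

  telescope : ∀ {P B h D} → P * h ≈ B * h + D → ∀ a →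
    P ^ a * h ≈ B ^ a * h + Σ< a (λ t → B ^ (a ∸ t ∸ 1) * P ^ t) * D
  telescope {P} {B} {h} {D} step zero = sym (trans (+-congˡ (zeroˡ D)) (+-identityʳ _))
  telescope {P} {B} {h} {D} step (suc a) = begin
    P * P ^ a * h                     ≈⟨ *-assoc _ _ _ ⟩
    P * (P ^ a * h)                   ≈⟨ *-congˡ (telescope step a) ⟩
    P * (B ^ a * h + Σa * D)
      ≈⟨ solve 5 (λ p ba hh sa d → p :* (ba :* hh :+ sa :* d) := ba :* (p :* hh) :+ (p :* sa) :* d)
                 refl P (B ^ a) h Σa D ⟩
    B ^ a * (P * h) + (P * Σa) * D    ≈⟨ +-cong (*-congˡ step) (*-congʳ shift) ⟩
    B ^ a * (B * h + D) + Σa′ * D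
      ≈⟨ solve 5 (λ b ba hh sa d → ba :* (b :* hh :+ d) :+ sa :* d := b :* ba :* hh :+ (ba :* con 1 :+ sa) :* d)
                 refl B (B ^ a) h Σa′ D ⟩
    B * B ^ a * h + (B ^ a * 1# + Σa′) * D
      ≈⟨ +-congˡ (*-congʳ (sym (Σ-first a _))) ⟩
    B * B ^ a * h + Σ< (suc a) (λ t → B ^ (suc a ∸ t ∸ 1) * P ^ t) * D ∎
    where
    Σa Σa′ : A
    Σa  = Σ< a (λ t → B ^ (a ∸ t ∸ 1) * P ^ t)
    Σa′ = Σ< a (λ t → B ^ (a ∸ t ∸ 1) * (P * P ^ t))

    shift : P * Σa ≈ Σa′
    shift = trans (Σ-*ˡ a P _) (Σ-congᵖ a (λ t → solve 3 (λ p b pt → p :* (b :* pt) := b :* (p :* pt)) refl P (B ^ (a ∸ t ∸ 1)) (P ^ t)))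

  -- Chaining the one-step law from B 0 = 0 up to B r (the exponent is
  -- positive, so that B 0 ^ a = 0).
  telescope-chain : ∀ (B D : ℕ → A) {h} → B 0 ≈ 0# →
    (∀ j → B (suc j) * h ≈ B j * h + D j) → ∀ a r →
    B r ^ suc a * h ≈ Σ< r (λ j → Σ< (suc a) (λ t → B j ^ (suc a ∸ t ∸ 1) * B (suc j) ^ t) * D j)
  telescope-chain B D {h} B0≈0 step a zero = begin
    B 0 * B 0 ^ a * h ≈⟨ *-congʳ (*-congʳ B0≈0) ⟩
    0# * B 0 ^ a * h  ≈⟨ *-congʳ (zeroˡ _) ⟩
    0# * h            ≈⟨ zeroˡ h ⟩
    0#                ∎
  telescope-chain B D {h} B0≈0 step a (suc r) =
    trans (telescope (step r) (suc a)) (+-congʳ (telescope-chain B D B0≈0 step a r))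

module IndexArithmetic where
  open +-*-Solver

  -- exponent of q in the Cauchy product G j · G (j+1)
  geom-exponent : ∀ j i d → j ℕ.* i ℕ.+ suc j ℕ.* d ≡ j ℕ.* (i ℕ.+ d) ℕ.+ d
  geom-exponent = solve 3 (λ j i d → j :* i :+ (con 1 :+ j) :* d := j :* (i :+ d) :+ d) ≡.refl

  -- exponent of q in a right-hand-side term with i = p + l + 1, n - a = l + d
  middle-exponent : ∀ j l d → j ℕ.* suc (l ℕ.+ d) ℕ.+ d ≡ j ℕ.+ (j ℕ.* l ℕ.+ suc j ℕ.* d)
  middle-exponent = solve 3 (λ j l d → j :* (con 1 :+ (l :+ d)) :+ d := j :+ (j :* l :+ (con 1 :+ j) :* d)) ≡.refl

  -- n - i for the same term, where n = p + (l + d + 1) + t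
  middle-remainder : ∀ p l d t → p ℕ.+ (suc (l ℕ.+ d) ℕ.+ t) ∸ suc (p ℕ.+ l) ≡ d ℕ.+ t
  middle-remainder p l d t = ≡.trans (≡.cong (_∸ suc (p ℕ.+ l)) regroup) (ℕP.m+n∸m≡n (suc (p ℕ.+ l)) (d ℕ.+ t))
    where
    regroup : p ℕ.+ (suc (l ℕ.+ d) ℕ.+ t) ≡ suc (p ℕ.+ l) ℕ.+ (d ℕ.+ t)
    regroup = solve 4 (λ p l d t → p :+ ((con 1 :+ (l :+ d)) :+ t) := (con 1 :+ (p :+ l)) :+ (d :+ t)) ≡.refl p l d t

  -- n - i for i = p + N + k + 2 beyond the middle range
  upper-remainder : ∀ p N t k → p ℕ.+ (suc N ℕ.+ t) ∸ suc (p ℕ.+ (suc N ℕ.+ k)) ≡ t ∸ suc k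
  upper-remainder p N t k = ≡.trans (≡.cong (p ℕ.+ (suc N ℕ.+ t) ∸_) regroup)
    (≡.trans (ℕP.[m+n]∸[m+o]≡n∸o p (suc N ℕ.+ t) (suc N ℕ.+ suc k)) (ℕP.[m+n]∸[m+o]≡n∸o (suc N) t (suc k)))
    where
    regroup : suc (p ℕ.+ (suc N ℕ.+ k)) ≡ p ℕ.+ (suc N ℕ.+ suc k)
    regroup = solve 3 (λ p N k → con 1 :+ (p :+ ((con 1 :+ N) :+ k)) := p :+ ((con 1 :+ N) :+ (con 1 :+ k))) ≡.refl p N k

  -- For t < a ≤ n the range 1 ≤ i ≤ n splits as (a-t-1) + (n-a+1) + t.
  block-size : ∀ {a n t} → a ≤ n → t < a → (a ∸ t ∸ 1) ℕ.+ (suc (n ∸ a) ℕ.+ t) ≡ n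
  block-size {a} {n} {t} a≤n t<a = begin
    (a ∸ t ∸ 1) ℕ.+ (suc (n ∸ a) ℕ.+ t) ≡⟨ ≡.cong (ℕ._+ (suc (n ∸ a) ℕ.+ t)) a∸t∸1≡a∸[1+t] ⟩
    (a ∸ suc t) ℕ.+ (suc (n ∸ a) ℕ.+ t) ≡⟨ regroup (a ∸ suc t) (n ∸ a) t ⟩
    ((a ∸ suc t) ℕ.+ suc t) ℕ.+ (n ∸ a) ≡⟨ ≡.cong (ℕ._+ (n ∸ a)) (ℕP.m∸n+n≡m t<a) ⟩
    a ℕ.+ (n ∸ a)                       ≡⟨ ℕP.m+[n∸m]≡n a≤n ⟩
    n                                   ∎
    where
    open ≡.≡-Reasoning
    a∸t∸1≡a∸[1+t] : a ∸ t ∸ 1 ≡ a ∸ suc t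
    a∸t∸1≡a∸[1+t] = ≡.trans (ℕP.∸-+-assoc a t 1) (≡.cong (a ∸_) (ℕP.+-comm t 1))
    regroup : ∀ p N t → p ℕ.+ (suc N ℕ.+ t) ≡ (p ℕ.+ suc t) ℕ.+ N
    regroup = solve 3 (λ p N t → p :+ ((con 1 :+ N) :+ t) := (p :+ (con 1 :+ t)) :+ N) ≡.refl

module QSeries {c ℓ : Level} (R : CommutativeSemiring c ℓ) (q : CommutativeSemiring.Carrier R) where
  open CommutativeSemiring R renaming (Carrier to A) hiding (zero)
  open QDefs R
  open FiniteSums R
  open PowerSeries R
  open IndexArithmetic
  open import Relation.Binary.Reasoning.Setoid setoid
  open import Algebra.Solver.Ring.NaturalCoefficients.Default R
  import Algebra.Solver.Ring.NaturalCoefficients.Default seriesSemiring as SeriesSolver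
  open import Algebra.Properties.Semiring.Exp semiring using (^-homo-*; ^-congʳ)
  open import Algebra.Properties.Semiring.Mult semiring using (×-comm-*; ×-assoc-*; ×1-homo-*)
  open import Algebra.Properties.Monoid.Mult +-monoid using (×-congʳ)

  qint-suc : ∀ j → 1# + q * qint q j ≈ qint q (suc j)
  qint-suc zero    = solve 1 (λ q → con 1 :+ q :* con 0 := con 0 :+ con 1) refl q
  qint-suc (suc j) = begin
    1# + q * (qint q j + q ^ j)
      ≈⟨ solve 3 (λ q x w → con 1 :+ q :* (x :+ w) := (con 1 :+ q :* x) :+ q :* w) refl q (qint q j) (q ^ j) ⟩
    (1# + q * qint q j) + q * q ^ j ≈⟨ +-congʳ (qint-suc j) ⟩
    qint q (suc j) + q ^ suc j      ∎

  -- [j+m] split at either end:  [m] + [j] q^m = [j] + q^j [m]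
  qint-split : ∀ j m → qint q m + qint q j * q ^ m ≈ qint q j + q ^ j * qint q m
  qint-split j zero    = solve 2 (λ x w → con 0 :+ x :* con 1 := x :+ w :* con 0) refl (qint q j) (q ^ j)
  qint-split j (suc m) = begin
    ([m] + qᵐ) + [j] * (q * qᵐ)
      ≈⟨ solve 4 (λ Qm P x q → (Qm :+ P) :+ x :* (q :* P) := Qm :+ P :* (con 1 :+ q :* x)) refl [m] qᵐ [j] q ⟩
    [m] + qᵐ * (1# + q * [j])       ≈⟨ +-congˡ (*-congˡ (qint-suc j)) ⟩
    [m] + qᵐ * ([j] + qʲ)
      ≈⟨ solve 4 (λ Qm P x w → Qm :+ P :* (x :+ w) := (Qm :+ x :* P) :+ w :* P) refl [m] qᵐ [j] qʲ ⟩
    ([m] + [j] * qᵐ) + qʲ * qᵐ      ≈⟨ +-congʳ (qint-split j m) ⟩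
    ([j] + qʲ * [m]) + qʲ * qᵐ
      ≈⟨ solve 4 (λ Qm P x w → (x :+ w :* Qm) :+ w :* P := x :+ w :* (Qm :+ P)) refl [m] qᵐ [j] qʲ ⟩
    [j] + qʲ * ([m] + qᵐ)           ∎
    where
    [m] [j] qᵐ qʲ : A
    [m] = qint q m
    [j] = qint q j
    qᵐ  = q ^ m
    qʲ  = q ^ j

  geomSum : ℕ → ℕ → A
  geomSum k N = Σ< (suc N) (λ i → q ^ (k ℕ.* i))

  q^[k*0]≈1 : ∀ k → q ^ (k ℕ.* 0) ≈ 1#
  q^[k*0]≈1 k = ^-congʳ q (ℕP.*-zeroʳ k)

  -- The q-integer identity behind the one-step law B (j+1) H = B j H + D j:
  --   [j+1] Σ_{i≤N} q^((j+1)i) = [j] Σ_{i≤N} q^(ji) + q^j q^(jN) [N+1].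
  geomSum-step : ∀ j N →
    qint q (suc j) * geomSum (suc j) N ≈ qint q j * geomSum j N + q ^ j * (q ^ (j ℕ.* N) * qint q (suc N))
  geomSum-step j zero = begin
    [j+1] * (0# + q ^ (suc j ℕ.* 0))
      ≈⟨ *-congˡ (+-congˡ (q^[k*0]≈1 (suc j))) ⟩
    ([j] + qʲ) * (0# + 1#)
      ≈⟨ solve 2 (λ x w → (x :+ w) :* (con 0 :+ con 1) := x :* (con 0 :+ con 1) :+ w :* (con 1 :* (con 0 :+ con 1))) refl [j] qʲ ⟩
    [j] * (0# + 1#) + qʲ * (1# * (0# + 1#))
      ≈⟨ sym (+-cong (*-congˡ (+-congˡ (q^[k*0]≈1 j))) (*-congˡ (*-congʳ (q^[k*0]≈1 j)))) ⟩
    [j] * (0# + q ^ (j ℕ.* 0)) + qʲ * (q ^ (j ℕ.* 0) * (0# + q ^ 0)) ∎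
    where
    [j] [j+1] qʲ : A
    [j]   = qint q j
    [j+1] = qint q (suc j)
    qʲ    = q ^ j
  geomSum-step j (suc N) = begin
    [j+1] * (S′ + q ^ (suc j ℕ.* suc N))
      ≈⟨ *-congˡ (+-congˡ new-term) ⟩
    [j+1] * (S′ + (q * qᴺ) * (qʲ * E))
      ≈⟨ solve 6 (λ y S′ q F w E → y :* (S′ :+ (q :* F) :* (w :* E)) := y :* S′ :+ y :* ((q :* F) :* (w :* E))) refl [j+1] S′ q qᴺ qʲ E ⟩
    [j+1] * S′ + [j+1] * ((q * qᴺ) * (qʲ * E))
      ≈⟨ +-congʳ (geomSum-step j N) ⟩
    ([j] * S + qʲ * (E * [N+1])) + ([j] + qʲ) * ((q * qᴺ) * (qʲ * E))
      ≈⟨ solve 7 (λ x S w E Q1 q F → (x :* S :+ w :* (E :* Q1)) :+ (x :+ w) :* ((q :* F) :* (w :* E))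
                     := x :* S :+ (w :* E) :* (Q1 :+ x :* (q :* F)) :+ w :* ((q :* F) :* (w :* E)))
                 refl [j] S qʲ E [N+1] q qᴺ ⟩
    [j] * S + (qʲ * E) * ([N+1] + [j] * (q * qᴺ)) + qʲ * ((q * qᴺ) * (qʲ * E))
      ≈⟨ +-congʳ (+-congˡ (*-congˡ (qint-split j (suc N)))) ⟩
    [j] * S + (qʲ * E) * ([j] + qʲ * [N+1]) + qʲ * ((q * qᴺ) * (qʲ * E))
      ≈⟨ solve 7 (λ x S w E Q1 q F → x :* S :+ (w :* E) :* (x :+ w :* Q1) :+ w :* ((q :* F) :* (w :* E))
                     := x :* (S :+ w :* E) :+ w :* ((w :* E) :* (Q1 :+ q :* F)))
                 refl [j] S qʲ E [N+1] q qᴺ ⟩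
    [j] * (S + qʲ * E) + qʲ * ((qʲ * E) * ([N+1] + q * qᴺ))
      ≈⟨ sym (+-cong (*-congˡ (+-congˡ q^[j*[N+1]])) (*-congˡ (*-congʳ q^[j*[N+1]]))) ⟩
    [j] * (S + q ^ (j ℕ.* suc N)) + qʲ * (q ^ (j ℕ.* suc N) * ([N+1] + q ^ suc N)) ∎
    where
    [j] [j+1] qʲ qᴺ E [N+1] S S′ : A
    [j]   = qint q j
    [j+1] = qint q (suc j)
    qʲ    = q ^ j
    qᴺ    = q ^ N
    E     = q ^ (j ℕ.* N)
    [N+1] = qint q (suc N)
    S     = geomSum j N
    S′    = geomSum (suc j) N

    q^[j*[N+1]] : q ^ (j ℕ.* suc N) ≈ qʲ * E
    q^[j*[N+1]] = trans (^-congʳ q (ℕP.*-suc j N)) (^-homo-* q j (j ℕ.* N))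

    new-term : q ^ (suc j ℕ.* suc N) ≈ (q * qᴺ) * (qʲ * E)
    new-term = trans (^-homo-* q (suc N) (j ℕ.* suc N)) (*-congˡ q^[j*[N+1]])

  geom : ℕ → Series
  geom k l = q ^ (k ℕ.* l)

  ones : Series
  ones _ = 1#

  binomGeom : ℕ → ℕ → Series
  binomGeom k m l = ((m ℕ.+ l) C m) × q ^ (k ℕ.* l)

  geom-⊛-ones : ∀ k N → (geom k ⊛ ones) N ≈ geomSum k N
  geom-⊛-ones k N = Σ-congᵖ (suc N) (λ i → *-identityʳ _)

  geom-⊛-geom-suc : ∀ j N → (geom j ⊛ geom (suc j)) N ≈ q ^ (j ℕ.* N) * qint q (suc N)
  geom-⊛-geom-suc j N = begin
    Σ< (suc N) (λ i → q ^ (j ℕ.* i) * q ^ (suc j ℕ.* (N ∸ i))) ≈⟨ Σ-cong (suc N) merge ⟩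
    Σ< (suc N) (λ i → q ^ (j ℕ.* N) * q ^ (N ∸ i))            ≈⟨ sym (Σ-*ˡ (suc N) _ _) ⟩
    q ^ (j ℕ.* N) * Σ< (suc N) (λ i → q ^ (N ∸ i))            ≈⟨ *-congˡ (sym (Σ-reverse (suc N) (q ^_))) ⟩
    q ^ (j ℕ.* N) * qint q (suc N)                            ∎
    where
    merge : ∀ i → i < suc N → q ^ (j ℕ.* i) * q ^ (suc j ℕ.* (N ∸ i)) ≈ q ^ (j ℕ.* N) * q ^ (N ∸ i)
    merge i (s≤s i≤N) = begin
      q ^ (j ℕ.* i) * q ^ (suc j ℕ.* (N ∸ i)) ≈⟨ sym (^-homo-* q (j ℕ.* i) _) ⟩
      q ^ (j ℕ.* i ℕ.+ suc j ℕ.* (N ∸ i))     ≈⟨ ^-congʳ q (geom-exponent j i (N ∸ i)) ⟩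
      q ^ (j ℕ.* (i ℕ.+ (N ∸ i)) ℕ.+ (N ∸ i)) ≈⟨ ^-congʳ q (≡.cong (λ k → j ℕ.* k ℕ.+ (N ∸ i)) (ℕP.m+[n∸m]≡n i≤N)) ⟩
      q ^ (j ℕ.* N ℕ.+ (N ∸ i))               ≈⟨ ^-homo-* q (j ℕ.* N) _ ⟩
      q ^ (j ℕ.* N) * q ^ (N ∸ i)             ∎

  geom-^ : ∀ k m → geom k ^ˢ suc m ≋ binomGeom k m
  geom-^ k zero l = begin
    (geom k ⊛ const 1#) l ≈⟨ ⊛-comm (geom k) (const 1#) l ⟩
    (const 1# ⊛ geom k) l ≈⟨ const-⊛ 1# (geom k) l ⟩
    1# * q ^ (k ℕ.* l)    ≈⟨ *-identityˡ _ ⟩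
    q ^ (k ℕ.* l)         ≈⟨ sym (+-identityʳ _) ⟩
    binomGeom k 0 l       ∎
  geom-^ k (suc m) l = begin
    Σ< (suc l) (λ i → geom k i * (geom k ^ˢ suc m) (l ∸ i))
      ≈⟨ Σ-congᵖ (suc l) (λ i → *-congˡ (geom-^ k m (l ∸ i))) ⟩
    Σ< (suc l) (λ i → geom k i * binomGeom k m (l ∸ i))
      ≈⟨ Σ-cong (suc l) collect ⟩
    Σ< (suc l) (λ i → ((m ℕ.+ (l ∸ i)) C m) × geom k l)
      ≈⟨ Σ-reverse (suc l) _ ⟩
    Σ< (suc l) (λ i → ((m ℕ.+ (l ∸ (l ∸ i))) C m) × geom k l)
      ≈⟨ Σ-cong (suc l) (λ i i<1+l → reflexive (≡.cong (λ w → ((m ℕ.+ w) C m) × geom k l) (ℕP.m∸[m∸n]≡n (ℕP.≤-pred i<1+l)))) ⟩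
    Σ< (suc l) (λ i → ((m ℕ.+ i) C m) × geom k l)
      ≈⟨ Σ-× (suc l) _ (geom k l) ⟩
    Σℕ (suc l) (λ i → (m ℕ.+ i) C m) × geom k l
      ≈⟨ reflexive (≡.cong (_× geom k l) (hockey-stick m l)) ⟩
    binomGeom k (suc m) l ∎
    where
    collect : ∀ i → i < suc l → geom k i * binomGeom k m (l ∸ i) ≈ ((m ℕ.+ (l ∸ i)) C m) × geom k l
    collect i (s≤s i≤l) = trans (×-comm-* ((m ℕ.+ (l ∸ i)) C m) (geom k i) (geom k (l ∸ i)))
      (×-congʳ ((m ℕ.+ (l ∸ i)) C m) (begin
        q ^ (k ℕ.* i) * q ^ (k ℕ.* (l ∸ i)) ≈⟨ sym (^-homo-* q (k ℕ.* i) _) ⟩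
        q ^ (k ℕ.* i ℕ.+ k ℕ.* (l ∸ i))     ≈⟨ ^-congʳ q (≡.sym (ℕP.*-distribˡ-+ k i (l ∸ i))) ⟩
        q ^ (k ℕ.* (i ℕ.+ (l ∸ i)))         ≈⟨ ^-congʳ q (≡.cong (k ℕ.*_) (ℕP.m+[n∸m]≡n i≤l)) ⟩
        q ^ (k ℕ.* l)                       ∎))

  B : ℕ → Series
  B j = const (qint q j) ⊛ geom j

  D : ℕ → Series
  D j = const (q ^ j) ⊛ (geom j ⊛ geom (suc j))

  B-zero : B 0 ≋ zeroSeries
  B-zero n = trans (const-⊛ 0# (geom 0) n) (zeroˡ _)

  B-step : ∀ j → B (suc j) ⊛ ones ≋ B j ⊛ ones ⊕ D j
  B-step j N = begin
    (B (suc j) ⊛ ones) N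
      ≈⟨ const-⊛-⊛ (qint q (suc j)) (geom (suc j)) ones N ⟩
    qint q (suc j) * (geom (suc j) ⊛ ones) N
      ≈⟨ *-congˡ (geom-⊛-ones (suc j) N) ⟩
    qint q (suc j) * geomSum (suc j) N
      ≈⟨ geomSum-step j N ⟩
    qint q j * geomSum j N + q ^ j * (q ^ (j ℕ.* N) * qint q (suc N))
      ≈⟨ sym (+-cong (trans (const-⊛-⊛ (qint q j) (geom j) ones N) (*-congˡ (geom-⊛-ones j N)))
                     (trans (const-⊛ (q ^ j) (geom j ⊛ geom (suc j)) N) (*-congˡ (geom-⊛-geom-suc j N)))) ⟩
    (B j ⊛ ones ⊕ D j) N ∎

  lhs-coefficient : ∀ r a′ N →
    (B r ^ˢ suc a′ ⊛ ones) N ≈ qint q r ^ suc a′ * Σ< (suc N) (binomGeom r a′)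
  lhs-coefficient r a′ N = begin
    (B r ^ˢ suc a′ ⊛ ones) N
      ≈⟨ 𝕊.*-congʳ {ones} (scaled-^ (qint q r) (geom r) (suc a′)) N ⟩
    (const (qint q r ^ suc a′) ⊛ geom r ^ˢ suc a′ ⊛ ones) N
      ≈⟨ const-⊛-⊛ _ (geom r ^ˢ suc a′) ones N ⟩
    qint q r ^ suc a′ * Σ< (suc N) (λ s → (geom r ^ˢ suc a′) s * 1#)
      ≈⟨ *-congˡ (Σ-congᵖ (suc N) (λ s → trans (*-identityʳ _) (geom-^ r a′ s))) ⟩
    qint q r ^ suc a′ * Σ< (suc N) (binomGeom r a′) ∎

  -- Coefficient of x^N in a summand B j ^ p · B (j+1) ^ t · D j of the
  -- telescoped sum: the constants collect in front, the geometric series in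
  -- G j ^ (p+1) G (j+1) ^ (t+1).
  summand-coefficient : ∀ p t j N →
    (B j ^ˢ p ⊛ B (suc j) ^ˢ t ⊛ D j) N
      ≈ ((qint q j ^ p * qint q (suc j) ^ t) * q ^ j) * (binomGeom j p ⊛ binomGeom (suc j) t) N
  summand-coefficient p t j N = begin
    (B j ^ˢ p ⊛ B (suc j) ^ˢ t ⊛ D j) N
      ≈⟨ 𝕊.*-congʳ {D j} (𝕊.*-cong (scaled-^ x (geom j) p) (scaled-^ y (geom (suc j)) t)) N ⟩
    (const (x ^ p) ⊛ Gᵖ ⊛ (const (y ^ t) ⊛ G′ᵗ) ⊛ (const w ⊛ (geom j ⊛ geom (suc j)))) N
      ≈⟨ SeriesSolver.solve 7 (λ a b c d e f g → a ⊠ b ⊠ (c ⊠ d) ⊠ (e ⊠ (f ⊠ g)) ≐ (a ⊠ c ⊠ e) ⊠ ((f ⊠ b) ⊠ (g ⊠ d)))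
                        𝕊.refl (const (x ^ p)) Gᵖ (const (y ^ t)) G′ᵗ (const w) (geom j) (geom (suc j)) N ⟩
    (const (x ^ p) ⊛ const (y ^ t) ⊛ const w ⊛ (geom j ^ˢ suc p ⊛ geom (suc j) ^ˢ suc t)) N
      ≈⟨ 𝕊.*-congʳ {geom j ^ˢ suc p ⊛ geom (suc j) ^ˢ suc t}
           (𝕊.trans (𝕊.*-congʳ {const w} (const-* (x ^ p) (y ^ t))) (const-* (x ^ p * y ^ t) w)) N ⟩
    (const ((x ^ p * y ^ t) * w) ⊛ (geom j ^ˢ suc p ⊛ geom (suc j) ^ˢ suc t)) N
      ≈⟨ const-⊛ _ (geom j ^ˢ suc p ⊛ geom (suc j) ^ˢ suc t) N ⟩
    ((x ^ p * y ^ t) * w) * (geom j ^ˢ suc p ⊛ geom (suc j) ^ˢ suc t) N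
      ≈⟨ *-congˡ (𝕊.*-cong (geom-^ j p) (geom-^ (suc j) t) N) ⟩
    ((x ^ p * y ^ t) * w) * (binomGeom j p ⊛ binomGeom (suc j) t) N ∎
    where
    open SeriesSolver using () renaming (_:*_ to _⊠_; _:=_ to _≐_)
    x y w : A
    x = qint q j
    y = qint q (suc j)
    w = q ^ j
    Gᵖ G′ᵗ : Series
    Gᵖ  = geom j ^ˢ p
    G′ᵗ = geom (suc j) ^ˢ t

  ×-as-* : ∀ m z → m × z ≈ (m × 1#) * z
  ×-as-* m z = sym (trans (×-assoc-* m 1# z) (×-congʳ m (*-identityˡ z)))

  -- The summand of the right-hand side at i = i′ + 1, with a-t-1 written p,
  -- n-a+1 written M, and X standing for [j]^p [j+1]^t.
  rhsTerm : (n p t M j : ℕ) → A → ℕ → A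
  rhsTerm n p t M j X i′ = (((n ∸ suc i′) C t) ℕ.* (i′ C p)) × (q ^ (j ℕ.* M ℕ.+ (n ∸ suc i′ ∸ t)) * X)

  -- In the middle range i′ = p + l, with n = p + (N+1) + t and N = l + d,
  -- the summand is the l-th term of the Cauchy product of binomial-geometric
  -- series.
  rhsTerm-middle : ∀ p t j X l d {N} → l ℕ.+ d ≡ N →
    rhsTerm (p ℕ.+ (suc N ℕ.+ t)) p t (suc N) j X (p ℕ.+ l)
      ≈ (X * q ^ j) * (binomGeom j p l * binomGeom (suc j) t d)
  rhsTerm-middle p t j X l d ≡.refl = begin
    (((n ∸ suc (p ℕ.+ l)) C t) ℕ.* c₂) × (q ^ (j ℕ.* suc N ℕ.+ (n ∸ suc (p ℕ.+ l) ∸ t)) * X)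
      ≈⟨ reflexive (≡.cong (λ k → ((k C t) ℕ.* c₂) × (q ^ (j ℕ.* suc N ℕ.+ (k ∸ t)) * X)) (middle-remainder p l d t)) ⟩
    (((d ℕ.+ t) C t) ℕ.* c₂) × (q ^ (j ℕ.* suc N ℕ.+ (d ℕ.+ t ∸ t)) * X)
      ≈⟨ reflexive (≡.cong₂ (λ u v → ((u C t) ℕ.* c₂) × (q ^ (j ℕ.* suc N ℕ.+ v) * X)) (ℕP.+-comm d t) (ℕP.m+n∸n≡m d t)) ⟩
    (c₁ ℕ.* c₂) × (q ^ (j ℕ.* suc N ℕ.+ d) * X)
      ≈⟨ ×-as-* (c₁ ℕ.* c₂) _ ⟩
    ((c₁ ℕ.* c₂) × 1#) * (q ^ (j ℕ.* suc N ℕ.+ d) * X)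
      ≈⟨ *-cong (×1-homo-* c₁ c₂) (*-congʳ exponent) ⟩
    ((c₁ × 1#) * (c₂ × 1#)) * ((q ^ j * (q ^ (j ℕ.* l) * q ^ (suc j ℕ.* d))) * X)
      ≈⟨ solve 6 (λ a b w u v x → (a :* b) :* ((w :* (u :* v)) :* x) := (x :* w) :* ((b :* u) :* (a :* v)))
                 refl (c₁ × 1#) (c₂ × 1#) (q ^ j) (q ^ (j ℕ.* l)) (q ^ (suc j ℕ.* d)) X ⟩
    (X * q ^ j) * (((c₂ × 1#) * q ^ (j ℕ.* l)) * ((c₁ × 1#) * q ^ (suc j ℕ.* d)))
      ≈⟨ *-congˡ (sym (*-cong (×-as-* c₂ _) (×-as-* c₁ _))) ⟩
    (X * q ^ j) * (binomGeom j p l * binomGeom (suc j) t d) ∎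
    where
    N n c₁ c₂ : ℕ
    N  = l ℕ.+ d
    n  = p ℕ.+ (suc N ℕ.+ t)
    c₁ = (t ℕ.+ d) C t
    c₂ = (p ℕ.+ l) C p

    exponent : q ^ (j ℕ.* suc N ℕ.+ d) ≈ q ^ j * (q ^ (j ℕ.* l) * q ^ (suc j ℕ.* d))
    exponent = trans (^-congʳ q (middle-exponent j l d))
                     (trans (^-homo-* q j _) (*-congˡ (^-homo-* q (j ℕ.* l) (suc j ℕ.* d))))

  -- Summing the right-hand side over i for fixed j and t: only the middle
  -- range p ≤ i′ ≤ p + N contributes, since C(i′, p) = 0 below it and
  -- C(n-i, t) = 0 above it.
  row-sum : ∀ p t N j X →
    Σ< (p ℕ.+ (suc N ℕ.+ t)) (rhsTerm (p ℕ.+ (suc N ℕ.+ t)) p t (suc N) j X)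
      ≈ (X * q ^ j) * (binomGeom j p ⊛ binomGeom (suc j) t) N
  row-sum p t N j X = begin
    Σ< (p ℕ.+ (suc N ℕ.+ t)) f
      ≈⟨ Σ-split p (suc N ℕ.+ t) f ⟩
    Σ< p f + Σ< (suc N ℕ.+ t) (λ i → f (p ℕ.+ i))
      ≈⟨ +-cong (Σ-zero p f below) (Σ-split (suc N) t (λ i → f (p ℕ.+ i))) ⟩
    0# + (Σ< (suc N) (λ l → f (p ℕ.+ l)) + Σ< t (λ k → f (p ℕ.+ (suc N ℕ.+ k))))
      ≈⟨ +-congˡ (+-cong (Σ-cong (suc N) middle) (Σ-zero t _ above)) ⟩
    0# + (Σ< (suc N) (λ l → (X * q ^ j) * convTerm l) + 0#)
      ≈⟨ trans (+-identityˡ _) (+-identityʳ _) ⟩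
    Σ< (suc N) (λ l → (X * q ^ j) * convTerm l)
      ≈⟨ sym (Σ-*ˡ (suc N) (X * q ^ j) convTerm) ⟩
    (X * q ^ j) * (binomGeom j p ⊛ binomGeom (suc j) t) N ∎
    where
    n : ℕ
    n = p ℕ.+ (suc N ℕ.+ t)

    f convTerm : ℕ → A
    f = rhsTerm n p t (suc N) j X
    convTerm l = binomGeom j p l * binomGeom (suc j) t (N ∸ l)

    below : ∀ i′ → i′ < p → f i′ ≈ 0#
    below i′ i′<p = reflexive (≡.cong (λ c → c × (q ^ (j ℕ.* suc N ℕ.+ (n ∸ suc i′ ∸ t)) * X))
      (≡.trans (≡.cong (((n ∸ suc i′) C t) ℕ.*_) (k>n⇒nCk≡0 i′<p)) (ℕP.*-zeroʳ ((n ∸ suc i′) C t))))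

    above : ∀ k → k < t → f (p ℕ.+ (suc N ℕ.+ k)) ≈ 0#
    above k k<t = reflexive (≡.cong (λ c → c × (q ^ (j ℕ.* suc N ℕ.+ (n ∸ suc i′ ∸ t)) * X))
      (≡.cong (ℕ._* (i′ C p)) (≡.trans (≡.cong (_C t) (upper-remainder p N t k)) (k>n⇒nCk≡0 t∸[k+1]<t))))
      where
      i′ : ℕ
      i′ = p ℕ.+ (suc N ℕ.+ k)
      t∸[k+1]<t : t ∸ suc k < t
      t∸[k+1]<t = ℕP.∸-monoʳ-< (s≤s z≤n) k<t

    middle : ∀ l → l < suc N → f (p ℕ.+ l) ≈ (X * q ^ j) * convTerm l
    middle l (s≤s l≤N) = rhsTerm-middle p t j X l (N ∸ l) (ℕP.m+[n∸m]≡n l≤N)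

  block-coefficient : ∀ n a j → a ≤ n →
    (Σˢ a (λ t → B j ^ˢ (a ∸ t ∸ 1) ⊛ B (suc j) ^ˢ t) ⊛ D j) (n ∸ a)
      ≈ Σ< a (λ t → Σ< n (rhsTerm n (a ∸ t ∸ 1) t (n ∸ a ℕ.+ 1) j (qint q j ^ (a ∸ t ∸ 1) * qint q (suc j) ^ t)))
  block-coefficient n a j a≤n = begin
    (Σˢ a F ⊛ D j) N             ≈⟨ FiniteSums.Σ-*ʳ seriesSemiring a (D j) F N ⟩
    Σˢ a (λ t → F t ⊛ D j) N     ≈⟨ coeff-Σ a (λ t → F t ⊛ D j) N ⟩
    Σ< a (λ t → (F t ⊛ D j) N)   ≈⟨ Σ-cong a slice ⟩
    Σ< a (λ t → Σ< n (rhsTerm n (a ∸ t ∸ 1) t (N ℕ.+ 1) j (X t))) ∎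
    where
    N : ℕ
    N = n ∸ a

    F : ℕ → Series
    F t = B j ^ˢ (a ∸ t ∸ 1) ⊛ B (suc j) ^ˢ t

    X : ℕ → A
    X t = qint q j ^ (a ∸ t ∸ 1) * qint q (suc j) ^ t

    slice : ∀ t → t < a → (F t ⊛ D j) N ≈ Σ< n (rhsTerm n (a ∸ t ∸ 1) t (N ℕ.+ 1) j (X t))
    slice t t<a = begin
      (F t ⊛ D j) N
        ≈⟨ summand-coefficient p t j N ⟩
      (X t * q ^ j) * (binomGeom j p ⊛ binomGeom (suc j) t) N
        ≈⟨ sym (row-sum p t N j (X t)) ⟩
      Σ< (p ℕ.+ (suc N ℕ.+ t)) (rhsTerm (p ℕ.+ (suc N ℕ.+ t)) p t (suc N) j (X t))
        ≈⟨ reflexive (≡.cong₂ (λ m M → Σ< m (rhsTerm m p t M j (X t))) (block-size a≤n t<a) (ℕP.+-comm 1 N)) ⟩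
      Σ< n (rhsTerm n p t (N ℕ.+ 1) j (X t)) ∎
      where
      p : ℕ
      p = a ∸ t ∸ 1

-- Proposition 4.6.  The left-hand side is a coefficient of B r ^ a H, which
-- telescopes into blocks indexed by j < r; the coefficient of each block is
-- a slice of the right-hand side, whose summation order is (j, t, i) instead
-- of (i, j, t).
proposition4p6 : {c ℓ : Level} (R : CommutativeSemiring c ℓ) (q : CommutativeSemiring.Carrier R)
    (n a r : ℕ) → 1 ≤ a → a ≤ n → 1 ≤ r →
    CommutativeSemiring._≈_ R (QDefs.lhs R q n a r) (QDefs.rhs R q n a r)
proposition4p6 R q n a@(suc a′) r _ a≤n _ = begin
  lhs q n a r
    ≈⟨ sym (lhs-coefficient r a′ N) ⟩
  (B r ^ˢ a ⊛ ones) N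
    ≈⟨ telescope-chain B D {ones} B-zero B-step a′ r N ⟩
  Σˢ r (λ j → Σˢ a (λ t → B j ^ˢ (a ∸ t ∸ 1) ⊛ B (suc j) ^ˢ t) ⊛ D j) N
    ≈⟨ coeff-Σ r _ N ⟩
  Σ< r (λ j → (Σˢ a (λ t → B j ^ˢ (a ∸ t ∸ 1) ⊛ B (suc j) ^ˢ t) ⊛ D j) N)
    ≈⟨ Σ-congᵖ r (λ j → block-coefficient n a j a≤n) ⟩
  Σ< r (λ j → Σ< a (λ t → Σ< n (term j t)))
    ≈⟨ Σ-congᵖ r (λ j → Σ-swap a n (term j)) ⟩
  Σ< r (λ j → Σ< n (λ i′ → Σ< a (λ t → term j t i′)))
    ≈⟨ Σ-swap r n (λ j i′ → Σ< a (λ t → term j t i′)) ⟩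
  rhs q n a r ∎
  where
  open CommutativeSemiring R renaming (Carrier to A) hiding (zero)
  open QDefs R
  open FiniteSums R
  open PowerSeries R
  open QSeries R q
  open Telescoping seriesSemiring using (telescope-chain)
  open import Relation.Binary.Reasoning.Setoid setoid

  N : ℕ
  N = n ∸ a

  term : ℕ → ℕ → ℕ → A
  term j t = rhsTerm n (a ∸ t ∸ 1) t (N ℕ.+ 1) j (qint q j ^ (a ∸ t ∸ 1) * qint q (suc j) ^ t)
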